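{- Let $(\mathcal C,\mathcal S)$ be a conjunctive algebra. Then the following belong to $\mathcal S$ for all $a,b,c\in\mathbb C$: 1. $(a\otimes(b\otimes c))\multimap((a\otimes b)\otimes c)$. 2. $(a\otimes b)^\perp\multimap(b\otimes a)^\perp$. 3. $(a\otimes(b\otimes c))^\perp\multimap((a\otimes b)\otimes c)^\perp$ and $((a\otimes b)\otimes c)^\perp\multimap(a\otimes(b\otimes c))^\perp$. 4. $a\multimap b\multimap(a\otimes b)$. 5. $(a⅋b)\multimap(b⅋a)$. 6. $(a⅋b)⅋c\multimap a⅋(b⅋c)$ and $a⅋(b⅋c)\multimap(a⅋b)⅋c$. 7. $(a⅋\mathbf 1^\perp)\multimap a$ and $a\multimap(a⅋\mathbf 1^\perp)$.
   Context: A conjunctive structure $(\mathbb C,\otimes,(\ )^\perp,\preccurlyeq)$: $(\mathbb C,\bigvee,\preccurlyeq)$ complete join-semilattice (hence complete lattice with meets $\bigwedge$), $\otimes$ monotone, $(\ )^\perp$ antimonotone and involutive, $\otimes$ distributes over arbitrary joins on both sides, $(\bigvee\mathfrak B)^\perp=\bigwedge_{b\in\mathfrak B}b^\perp$. Define $a⅋b:=(a^\perp\otimes b^\perp)^\perp$, $a\multimap b:=(a\otimes b^\perp)^\perp$ (right-associative). A conjunctive algebra adds a unit $\mathbf 1$ and $\mathcal S\subseteq\mathbb C$ containing $\mathbf 1$ and $S_3:=\bigwedge_{a,b}(a\otimes b\multimap b\otimes a)$, $S_4:=\bigwedge_{a,b,c}(a\multimap b)\multimap(b\multimap c)\multimap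 a\multimap c$, $S_5:=\bigwedge_{a,b,c}((a\otimes b)\otimes c)\multimap(a\otimes(b\otimes c))$, $S_6:=\bigwedge_a a\multimap(\mathbf 1\otimes a)$, $S_7:=\bigwedge_a(\mathbf 1\otimes a)\multimap a$, upward closed, closed under modus ponens, under $a\multimap b\in\mathcal S\Rightarrow a\otimes c\multimap b\otimes c\in\mathcal S$, and under $a\multimap b\in\mathcal S\Rightarrow b^\perp\multimap a^\perp\in\mathcal S$. -}

module Defs where

open import Level using (Level; _⊔_; suc)
open import Data.Product using (Σ; ∃; ∃-syntax; _×_; _,_)
open import Relation.Binary.PropositionalEquality using (_≡_)

Subset : ∀ {c} → Set c → Set (suc c)
Subset {c} A = A → Set c

record ConjunctiveStructure (c : Level) : Set (suc c) where
  infix  4 _≼_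
  infixl 7 _⊗_
  field
    Carrier : Set c
    _≼_     : Carrier → Carrier → Set c
    ≼-refl    : ∀ {a} → a ≼ a
    ≼-trans   : ∀ {a b d} → a ≼ b → b ≼ d → a ≼ d
    ≼-antisym : ∀ {a b} → a ≼ b → b ≼ a → a ≡ b
    ⋁        : Subset Carrier → Carrier
    ⋁-upper  : ∀ (B : Subset Carrier) {b} → B b → b ≼ ⋁ B
    ⋁-least  : ∀ (B : Subset Carrier) {u} → (∀ {b} → B b → b ≼ u) → ⋁ B ≼ u
    _⊗_ : Carrier → Carrier → Carrier
    _⊥  : Carrier → Carrier
    ⊗-mono   : ∀ {a a′ b b′} → a ≼ a′ → b ≼ b′ → a ⊗ b ≼ a′ ⊗ b′
    ⊥-antimono : ∀ {a b} → a ≼ b → b ⊥ ≼ a ⊥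
    ⊥-invol  : ∀ a → (a ⊥) ⊥ ≡ a

  ⋀ : Subset Carrier → Carrier
  ⋀ B = ⋁ (λ x → ∀ {b} → B b → x ≼ b)

  field
    ⊗-distribʳ-⋁ : ∀ (B : Subset Carrier) a →
                   (⋁ B) ⊗ a ≡ ⋁ (λ x → ∃[ b ] (B b × x ≡ b ⊗ a))
    ⊗-distribˡ-⋁ : ∀ (B : Subset Carrier) a →
                   a ⊗ (⋁ B) ≡ ⋁ (λ x → ∃[ b ] (B b × x ≡ a ⊗ b))
    ⊥-⋁ : ∀ (B : Subset Carrier) →
          (⋁ B) ⊥ ≡ ⋀ (λ x → ∃[ b ] (B b × x ≡ b ⊥))

  infixr 6 _⅋_
  infixr 5 _⊸_
  _⅋_ : Carrier → Carrier → Carrier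
  a ⅋ b = ((a ⊥) ⊗ (b ⊥)) ⊥

  _⊸_ : Carrier → Carrier → Carrier
  a ⊸ b = (a ⊗ (b ⊥)) ⊥

record ConjunctiveAlgebra (c s : Level) : Set (suc (c ⊔ s)) where
  field
    structure : ConjunctiveStructure c
  open ConjunctiveStructure structure public
  field
    𝟙 : Carrier
    𝒮 : Carrier → Set s

  S₃ : Carrier
  S₃ = ⋀ (λ x → ∃[ a ] ∃[ b ] (x ≡ (a ⊗ b ⊸ b ⊗ a)))

  S₄ : Carrier
  S₄ = ⋀ (λ x → ∃[ a ] ∃[ b ] ∃[ d ]
          (x ≡ ((a ⊸ b) ⊸ (b ⊸ d) ⊸ a ⊸ d)))

  S₅ : Carrier
  S₅ = ⋀ (λ x → ∃[ a ] ∃[ b ] ∃[ d ] (x ≡ (((a ⊗ b) ⊗ d) ⊸ (a ⊗ (b ⊗ d)))))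

  S₆ : Carrier
  S₆ = ⋀ (λ x → ∃[ a ] (x ≡ (a ⊸ (𝟙 ⊗ a))))

  S₇ : Carrier
  S₇ = ⋀ (λ x → ∃[ a ] (x ≡ ((𝟙 ⊗ a) ⊸ a)))

  field
    𝟙∈𝒮  : 𝒮 𝟙
    S₃∈𝒮 : 𝒮 S₃
    S₄∈𝒮 : 𝒮 S₄
    S₅∈𝒮 : 𝒮 S₅
    S₆∈𝒮 : 𝒮 S₆
    S₇∈𝒮 : 𝒮 S₇
    𝒮-upward : ∀ {a b} → 𝒮 a → a ≼ b → 𝒮 b
    𝒮-mp     : ∀ {a b} → 𝒮 (a ⊸ b) → 𝒮 a → 𝒮 b
    𝒮-⊗      : ∀ {a b} d → 𝒮 (a ⊸ b) → 𝒮 ((a ⊗ d) ⊸ (b ⊗ d))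
    𝒮-contra : ∀ {a b} → 𝒮 (a ⊸ b) → 𝒮 ((b ⊥) ⊸ (a ⊥))

{-# OPTIONS --safe #-}
-- Read ⊸ as entailment "realised by 𝒮". S₄ and modus ponens make it transitive,
-- S₆ and S₇ make it reflexive, and S₃ and S₅ give the symmetry and one direction
-- of associativity of ⊗; the other direction follows by rotating with S₃.
-- Currying is the contrapositive of reassociation, and every law for ⅋ is the
-- contrapositive of the dual law for ⊗ applied to negated arguments.
module Submission where

open import Defs
open import Level using (Level)
open import Data.Product using (_×_; _,_)
open import Relation.Binary.PropositionalEquality
  using (_≡_; refl; sym; cong; subst; subst₂)

module ConjunctiveStructureProperties {c : Level} (C : ConjunctiveStructure c) where
  open ConjunctiveStructure C

  ⋀-lowerBound : ∀ (B : Subset Carrier) {b} → B b → ⋀ B ≼ b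
  ⋀-lowerBound B b∈B = ⋁-least _ (λ isLowerBound → isLowerBound b∈B)

  ⅋-⊥ˡ : ∀ a b → (a ⊥) ⅋ b ≡ (a ⊗ (b ⊥)) ⊥
  ⅋-⊥ˡ a b = cong (λ x → (x ⊗ (b ⊥)) ⊥) (⊥-invol a)

  ⅋-⊥ʳ : ∀ a b → a ⅋ (b ⊥) ≡ ((a ⊥) ⊗ b) ⊥
  ⅋-⊥ʳ a b = cong (λ x → ((a ⊥) ⊗ x) ⊥) (⊥-invol b)

  ⅋-⊗-⊥ˡ : ∀ a b d → (a ⅋ b) ⅋ d ≡ (((a ⊥) ⊗ (b ⊥)) ⊗ (d ⊥)) ⊥
  ⅋-⊗-⊥ˡ a b d = ⅋-⊥ˡ ((a ⊥) ⊗ (b ⊥)) d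

  ⅋-⊗-⊥ʳ : ∀ a b d → a ⅋ (b ⅋ d) ≡ ((a ⊥) ⊗ ((b ⊥) ⊗ (d ⊥))) ⊥
  ⅋-⊗-⊥ʳ a b d = ⅋-⊥ʳ a ((b ⊥) ⊗ (d ⊥))

module ConjunctiveAlgebraProperties {c s : Level} (A : ConjunctiveAlgebra c s) where
  open ConjunctiveAlgebra A
  open ConjunctiveStructureProperties structure

  ⊸-resp-≡ : ∀ {a a′ b b′} → a ≡ a′ → b ≡ b′ → 𝒮 (a ⊸ b) → 𝒮 (a′ ⊸ b′)
  ⊸-resp-≡ = subst₂ (λ x y → 𝒮 (x ⊸ y))

  ⊗-comm : ∀ a b → 𝒮 (a ⊗ b ⊸ b ⊗ a)
  ⊗-comm a b = 𝒮-upward S₃∈𝒮 (⋀-lowerBound _ (a , b , refl))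

  ⊸-trans-realizer : ∀ a b d → 𝒮 ((a ⊸ b) ⊸ (b ⊸ d) ⊸ a ⊸ d)
  ⊸-trans-realizer a b d = 𝒮-upward S₄∈𝒮 (⋀-lowerBound _ (a , b , d , refl))

  ⊗-assoc : ∀ a b d → 𝒮 ((a ⊗ b) ⊗ d ⊸ a ⊗ (b ⊗ d))
  ⊗-assoc a b d = 𝒮-upward S₅∈𝒮 (⋀-lowerBound _ (a , b , d , refl))

  ⊗-identityˡ-intro : ∀ a → 𝒮 (a ⊸ 𝟙 ⊗ a)
  ⊗-identityˡ-intro a = 𝒮-upward S₆∈𝒮 (⋀-lowerBound _ (a , refl))

  ⊗-identityˡ-elim : ∀ a → 𝒮 (𝟙 ⊗ a ⊸ a)
  ⊗-identityˡ-elim a = 𝒮-upward S₇∈𝒮 (⋀-lowerBound _ (a , refl))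

  ⊸-trans : ∀ {a b d} → 𝒮 (a ⊸ b) → 𝒮 (b ⊸ d) → 𝒮 (a ⊸ d)
  ⊸-trans {a} {b} {d} a⊸b b⊸d = 𝒮-mp (𝒮-mp (⊸-trans-realizer a b d) a⊸b) b⊸d

  ⊸-refl : ∀ a → 𝒮 (a ⊸ a)
  ⊸-refl a = ⊸-trans (⊗-identityˡ-intro a) (⊗-identityˡ-elim a)

  ⊗-identityʳ-intro : ∀ a → 𝒮 (a ⊸ a ⊗ 𝟙)
  ⊗-identityʳ-intro a = ⊸-trans (⊗-identityˡ-intro a) (⊗-comm 𝟙 a)

  ⊗-identityʳ-elim : ∀ a → 𝒮 (a ⊗ 𝟙 ⊸ a)
  ⊗-identityʳ-elim a = ⊸-trans (⊗-comm a 𝟙) (⊗-identityˡ-elim a)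

  -- a(bd) → (bd)a → b(da) → (da)b → d(ab) → (ab)d
  ⊗-assoc⁻ : ∀ a b d → 𝒮 (a ⊗ (b ⊗ d) ⊸ (a ⊗ b) ⊗ d)
  ⊗-assoc⁻ a b d =
    ⊸-trans (⊗-comm a (b ⊗ d)) (⊸-trans (⊗-assoc b d a)
      (⊸-trans (⊗-comm b (d ⊗ a)) (⊸-trans (⊗-assoc d a b) (⊗-comm d (a ⊗ b)))))

  -- a ⊗ b ⊸ x and a ⊸ b ⊸ x are the negations of (a ⊗ b) ⊗ x ⊥ and a ⊗ (b ⊗ x ⊥).
  ⊸-curry : ∀ {a b x} → 𝒮 (a ⊗ b ⊸ x) → 𝒮 (a ⊸ b ⊸ x)
  ⊸-curry {a} {b} {x} ab⊸x =
    subst 𝒮 (cong (λ y → (a ⊗ y) ⊥) (sym (⊥-invol _)))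
      (𝒮-mp (𝒮-contra (⊗-assoc⁻ a b (x ⊥))) ab⊸x)

  ⊗-intro : ∀ a b → 𝒮 (a ⊸ b ⊸ a ⊗ b)
  ⊗-intro a b = ⊸-curry (⊸-refl (a ⊗ b))

  ⅋-comm : ∀ a b → 𝒮 (a ⅋ b ⊸ b ⅋ a)
  ⅋-comm a b = 𝒮-contra (⊗-comm (b ⊥) (a ⊥))

  ⅋-assoc : ∀ a b d → 𝒮 ((a ⅋ b) ⅋ d ⊸ a ⅋ (b ⅋ d))
  ⅋-assoc a b d = ⊸-resp-≡ (sym (⅋-⊗-⊥ˡ a b d)) (sym (⅋-⊗-⊥ʳ a b d))
    (𝒮-contra (⊗-assoc⁻ (a ⊥) (b ⊥) (d ⊥)))

  ⅋-assoc⁻ : ∀ a b d → 𝒮 (a ⅋ (b ⅋ d) ⊸ (a ⅋ b) ⅋ d)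
  ⅋-assoc⁻ a b d = ⊸-resp-≡ (sym (⅋-⊗-⊥ʳ a b d)) (sym (⅋-⊗-⊥ˡ a b d))
    (𝒮-contra (⊗-assoc (a ⊥) (b ⊥) (d ⊥)))

  ⅋-identityʳ-elim : ∀ a → 𝒮 (a ⅋ (𝟙 ⊥) ⊸ a)
  ⅋-identityʳ-elim a = ⊸-resp-≡ (sym (⅋-⊥ʳ a 𝟙)) (⊥-invol a)
    (𝒮-contra (⊗-identityʳ-intro (a ⊥)))

  ⅋-identityʳ-intro : ∀ a → 𝒮 (a ⊸ a ⅋ (𝟙 ⊥))
  ⅋-identityʳ-intro a = ⊸-resp-≡ (⊥-invol a) (sym (⅋-⊥ʳ a 𝟙))
    (𝒮-contra (⊗-identityʳ-elim (a ⊥)))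

proposition3p15 : ∀ {c s : Level} (A : ConjunctiveAlgebra c s) →
    let open ConjunctiveAlgebra A in
    ∀ a b d →
      -- 1
      𝒮 ((a ⊗ (b ⊗ d)) ⊸ ((a ⊗ b) ⊗ d))
      -- 2
      × 𝒮 (((a ⊗ b) ⊥) ⊸ ((b ⊗ a) ⊥))
      -- 3
      × 𝒮 (((a ⊗ (b ⊗ d)) ⊥) ⊸ (((a ⊗ b) ⊗ d) ⊥))
      × 𝒮 ((((a ⊗ b) ⊗ d) ⊥) ⊸ ((a ⊗ (b ⊗ d)) ⊥))
      -- 4
      × 𝒮 (a ⊸ (b ⊸ (a ⊗ b)))
      -- 5
      × 𝒮 ((a ⅋ b) ⊸ (b ⅋ a))
      -- 6
      × 𝒮 (((a ⅋ b) ⅋ d) ⊸ (a ⅋ (b ⅋ d)))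
      × 𝒮 ((a ⅋ (b ⅋ d)) ⊸ ((a ⅋ b) ⅋ d))
      -- 7
      × 𝒮 ((a ⅋ (𝟙 ⊥)) ⊸ a)
      × 𝒮 (a ⊸ (a ⅋ (𝟙 ⊥)))
proposition3p15 A a b d =
    ⊗-assoc⁻ a b d
  , 𝒮-contra (⊗-comm b a)
  , 𝒮-contra (⊗-assoc a b d)
  , 𝒮-contra (⊗-assoc⁻ a b d)
  , ⊗-intro a b
  , ⅋-comm a b
  , ⅋-assoc a b d
  , ⅋-assoc⁻ a b d
  , ⅋-identityʳ-elim a
  , ⅋-identityʳ-intro a
  where
    open ConjunctiveAlgebra A
    open ConjunctiveAlgebraProperties A
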